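{- Let $G_0(X)=\frac{X+8}{9}$ and let the labels $T^{s}_{r,d,X}$ be as defined in the context, computed from the all-one $n$-grid with $n$ sufficiently large. Then $T^{1}_{1,1,L}=\frac{2}{3}$ and, for every $s\ge 2$, $T^{s}_{2s-1,s,L}=G_0\big(T^{s-1}_{2s-3,s-1,L}\big)$.
   Context: The triangular $m$-grid consists of $m$ rows of upright unit triangles in the triangular lattice, row $r$ ($1\le r\le m$, counted top to bottom) containing $r$ upright triangles $T_{r,d}$, $1\le d\le r$, numbered left to right. Every edge of the grid is the left ($L$), right ($R$) or base ($B$) edge of exactly one upright triangle. Each edge carries a positive real label (a resistance). The all-one $n$-grid has every label equal to $1$. Reduction of a labeled $m$-grid ($m\ge2$) to a labeled $(m-1)$-grid: (1) replace each upright triangle with edge labels $a,b,c$ by a star with a new center vertex, the star edge to a vertex $v$ of the triangle getting label (product of the two triangle labels at $v$)$/(a+b+c)$; (2) delete the three pendant star edges at the three corner vertices of the grid; (3) each non-corner boundary vertex of the original grid now has degree 2: replace its two edges by one edge whose label is the sum of the two labels; (4) each interior vertex of the original grid is now the center of a claw with edge labels $x_1,x_2,x_3$ to three star centers: replace it by a triangle on those star centers, the edge between the leaves of $x_i,x_j$ getting label $(x_1x_2+x_2x_3+x_3x_1)/x_k$ where $\{i,j,k\}=\{1,2,3\}$. The result is a labeled $(m-1)$-grid whose triangle $T_{r,d}$ has as vertices the star centers of the parent triangles $T_{r,d}$ (top), $T_{r+1,d}$ (bottom left), $T_{r+1,d+1}$ (bottom right). $T^{s}_{r,d,X}$ ($X\in\{L,R,B\}$)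 denotes the label of edge $X$ of triangle $T_{r,d}$ in the grid obtained from the all-one $n$-grid by $s$ successive reductions. -}

module Defs where

open import Data.Nat as ℕ using (ℕ; zero; suc; _∸_; _≤ᵇ_)
open import Data.Integer using (+_; +[1+_]; -[1+_])
open import Data.Rational using (ℚ; mkℚ; _+_; _*_; _/_; 0ℚ; 1ℚ; _÷_)
open import Data.Bool using (if_then_else_)

-- Total division on ℚ (value 0 when dividing by 0).  All labels in the
-- reduction of the all-one grid are positive, so the default is never used.
_⊘_ : ℚ → ℚ → ℚ
p ⊘ q@(mkℚ (+ zero) _ _) = 0ℚ
p ⊘ q@(mkℚ +[1+ _ ] _ _) = p ÷ q
p ⊘ q@(mkℚ -[1+ _ ] _ _) = p ÷ q

infixl 7 _⊘_

data Side : Set where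
  L R B : Side

-- A labeled grid: label (r , d , X) of edge X of upright triangle T_{r,d}
-- (1 ≤ d ≤ r ≤ m, 1-based; values outside this range are irrelevant).
Labels : Set
Labels = ℕ → ℕ → Side → ℚ

-- Step (1): star edge labels.  T_{r,d} has vertices top (r-1,d-1),
-- bottom-left (r,d-1), bottom-right (r,d); L = top–bottom-left,
-- R = top–bottom-right, B = bottom-left–bottom-right.
perim : Labels → ℕ → ℕ → ℚ
perim T r d = T r d L + T r d R + T r d B

starTop starBL starBR : Labels → ℕ → ℕ → ℚ
starTop T r d = (T r d L * T r d R) ⊘ perim T r d
starBL  T r d = (T r d L * T r d B) ⊘ perim T r d
starBR  T r d = (T r d R * T r d B) ⊘ perim T r d

-- For a lattice vertex (i , j) (row i, position j, 0 ≤ j ≤ i ≤ m), the star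
-- edges to it coming from the (at most three) upright triangles containing it:
--   xt : from T_{i+1,j+1} (vertex is its top)
--   xl : from T_{i,j+1}   (vertex is its bottom-left)
--   xr : from T_{i,j}     (vertex is its bottom-right)
xt xl xr : Labels → ℕ → ℕ → ℚ
xt T i j = starTop T (suc i) (suc j)
xl T i j = starBL  T i (suc j)
xr T i j = starBR  T i j

-- Steps (3)/(4): a new edge joining the leaves a, b through an old vertex;
-- if the vertex is a boundary vertex (third leaf absent) the label is a + b,
-- otherwise it is the Y–Δ value (ab + bc + ca) / c with c the third leaf.
join : (boundary : Data.Bool.Bool) → ℚ → ℚ → ℚ → ℚ
join boundary a b c =
  if boundary then a + b else (a * b + b * c + c * a) ⊘ c

-- New triangle T_{r,d} has vertices the star centres of old T_{r,d} (top),
-- T_{r+1,d} (bottom-left), T_{r+1,d+1} (bottom-right).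
--   new L passes through old vertex (r , d-1): leaves xl (old T_{r,d}),
--     xt (old T_{r+1,d}); third leaf xr (old T_{r,d-1}), absent iff d = 1.
--   new R passes through old vertex (r , d): leaves xr (old T_{r,d}),
--     xt (old T_{r+1,d+1}); third leaf xl (old T_{r,d+1}), absent iff d = r.
--   new B passes through old vertex (r+1 , d): leaves xr (old T_{r+1,d}),
--     xl (old T_{r+1,d+1}); third leaf xt (old T_{r+2,d+1}), absent iff r+1 = m.
reduce : (m : ℕ) → Labels → Labels
reduce m T r d L =
  join (d ≤ᵇ 1) (xl T r (d ∸ 1)) (xt T r (d ∸ 1)) (xr T r (d ∸ 1))
reduce m T r d R =
  join (r ≤ᵇ d) (xr T r d) (xt T r d) (xl T r d)
reduce m T r d B =
  join (m ≤ᵇ suc r) (xr T (suc r) d) (xl T (suc r) d) (xt T (suc r) d)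

iterLabels : (n s : ℕ) → Labels
iterLabels n zero = λ _ _ _ → 1ℚ
iterLabels n (suc s) = reduce (n ∸ s) (iterLabels n s)

Tlab : (n s r d : ℕ) → Side → ℚ
Tlab n s r d X = iterLabels n s r d X

G₀ : ℚ → ℚ
G₀ x = (x + + 8 / 1) * (+ 1 / 9)

{-# OPTIONS --safe #-}
-- Starting from the all-one grid, every triangle at
-- distance at least s from the boundary of the s-times reduced grid is still all-one:
-- its star legs are 1/3 and three 1/3-legs give back Y-Δ labels 1.  In the column
-- d = s the R- and B-edges are 1 while the L-edge carries some a; the leg of such a
-- triangle at its bottom-right corner is 1/(a+2), and with the two 1/3-legs beside it
-- the Y-Δ label of the next L-edge is (1/9 + 2/(3(a+2)))(a+2) = (a+8)/9 = G₀(a).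
-- In the first reduction the column d = 1 lies on the boundary, so a = 1/3 + 1/3.
module Submission where

open import Defs
open import Data.Nat using (ℕ; _≤_; _*_; _∸_)
open import Data.Product using (_×_; ∃)
open import Data.Integer using (+_)
open import Data.Rational using (ℚ; _/_)
open import Relation.Binary.PropositionalEquality using (_≡_)

open import Data.Bool using (false)
open import Data.Integer using (+[1+_]; -[1+_])
open import Data.Nat using (suc; zero; pred; _+_; _<_; _≤ᵇ_; s≤s; z≤n)
open import Data.Nat.Properties
  using ( _≤?_; <⇒≱; <⇒≤; ≤-refl; ≤-reflexive; ≤-trans; m≤n⇒m≤1+n; m<n⇒m<1+n; m≤m+n
        ; +-suc; +-identityʳ; *-suc; m+n≤o⇒m≤o; m+n≤o⇒n≤o; m+n≤o⇒m≤o∸n; pred[m∸n]≡m∸[1+n])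
open import Data.Product using (_,_; proj₁; proj₂)
open import Data.Rational as ℚ using (_÷_; mkℚ; 1ℚ; 1/_; Positive; NonZero)
open import Data.Rational.Properties
  using (*-assoc; *-identityʳ; *-inverseˡ; *-inverseʳ; pos⇒nonZero; pos+pos⇒pos; pos*pos⇒pos; 1/pos⇒pos)
import Data.Rational.Solver as ℚ-Solver
open import Relation.Binary.PropositionalEquality using (refl; sym; cong; subst; module ≡-Reasoning)
open import Relation.Nullary.Decidable using (dec-false)

open ≡-Reasoning

⅓ : ℚ
⅓ = + 1 / 3

⊘≡÷ : ∀ p q .{{_ : NonZero q}} → p ⊘ q ≡ p ÷ q
⊘≡÷ p (mkℚ +[1+ _ ] _ _) = refl
⊘≡÷ p (mkℚ -[1+ _ ] _ _) = refl

r*q≡p⇒p⊘q≡r : ∀ {p r} q .{{_ : NonZero q}} → r ℚ.* q ≡ p → p ⊘ q ≡ r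
r*q≡p⇒p⊘q≡r {p} {r} q r*q≡p = begin
  p ⊘ q              ≡⟨ ⊘≡÷ p q ⟩
  p ℚ.* 1/ q         ≡⟨ cong (ℚ._* 1/ q) (sym r*q≡p) ⟩
  r ℚ.* q ℚ.* 1/ q   ≡⟨ *-assoc r q (1/ q) ⟩
  r ℚ.* (q ℚ.* 1/ q) ≡⟨ cong (r ℚ.*_) (*-inverseʳ q) ⟩
  r ℚ.* 1ℚ           ≡⟨ *-identityʳ r ⟩
  r                  ∎

G₀-positive : ∀ a → .{{Positive a}} → Positive (G₀ a)
G₀-positive a = pos*pos⇒pos (a ℚ.+ + 8 / 1) {{pos+pos⇒pos a (+ 8 / 1)}} (+ 1 / 9)

Y-Δ-G₀ : ∀ {b x y z} a → .{{Positive a}} →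
  b ≡ false → x ≡ ⅓ → y ≡ ⅓ → z ≡ 1ℚ ⊘ (a ℚ.+ 1ℚ ℚ.+ 1ℚ) → join b x y z ≡ G₀ a
Y-Δ-G₀ a refl refl refl refl = begin
  (⅓ ℚ.* ⅓ ℚ.+ ⅓ ℚ.* x ℚ.+ x ℚ.* ⅓) ⊘ x ≡⟨ cong (λ w → (⅓ ℚ.* ⅓ ℚ.+ ⅓ ℚ.* w ℚ.+ w ℚ.* ⅓) ⊘ w) x≡1/p ⟩
  (⅓ ℚ.* ⅓ ℚ.+ ⅓ ℚ.* 1/ p ℚ.+ 1/ p ℚ.* ⅓) ⊘ 1/ p ≡⟨ r*q≡p⇒p⊘q≡r (1/ p) {{pos⇒nonZero (1/ p) {{1/pos⇒pos p}}}} G₀a*[1/p] ⟩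
  G₀ a ∎
  where
  open ℚ-Solver.+-*-Solver
  p = a ℚ.+ 1ℚ ℚ.+ 1ℚ
  instance
    p-positive : Positive p
    p-positive = pos+pos⇒pos (a ℚ.+ 1ℚ) {{pos+pos⇒pos a 1ℚ}} 1ℚ
    p-nonZero : NonZero p
    p-nonZero = pos⇒nonZero p
  x = 1ℚ ⊘ p
  x≡1/p : x ≡ 1/ p
  x≡1/p = r*q≡p⇒p⊘q≡r p (*-inverseˡ p)
  G₀a*[1/p] : G₀ a ℚ.* 1/ p ≡ ⅓ ℚ.* ⅓ ℚ.+ ⅓ ℚ.* 1/ p ℚ.+ 1/ p ℚ.* ⅓
  G₀a*[1/p] = begin
    G₀ a ℚ.* 1/ p
      ≡⟨ solve 2 (λ a y → ((a :+ con (+ 8 / 1)) :* con (+ 1 / 9)) :* y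
                     := con (+ 1 / 9) :* ((a :+ con 1ℚ :+ con 1ℚ) :* y) :+ con (+ 2 / 3) :* y) refl a (1/ p) ⟩
    + 1 / 9 ℚ.* (p ℚ.* 1/ p) ℚ.+ + 2 / 3 ℚ.* 1/ p
      ≡⟨ cong (λ z → + 1 / 9 ℚ.* z ℚ.+ + 2 / 3 ℚ.* 1/ p) (*-inverseʳ p) ⟩
    + 1 / 9 ℚ.* 1ℚ ℚ.+ + 2 / 3 ℚ.* 1/ p
      ≡⟨ solve 1 (λ y → con (+ 1 / 9) :* con 1ℚ :+ con (+ 2 / 3) :* y
                     := con ⅓ :* con ⅓ :+ con ⅓ :* y :+ y :* con ⅓) refl (1/ p) ⟩
    ⅓ ℚ.* ⅓ ℚ.+ ⅓ ℚ.* 1/ p ℚ.+ 1/ p ℚ.* ⅓ ∎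

<⇒≤ᵇ≡false : ∀ {m n} → n < m → (m ≤ᵇ n) ≡ false
<⇒≤ᵇ≡false {m} {n} n<m = dec-false (m ≤? n) (<⇒≱ n<m)

record AllOne (T : Labels) (r d : ℕ) : Set where
  field edge : ∀ X → T r d X ≡ 1ℚ
open AllOne

starTop-ones : ∀ {T r d} → AllOne T r d → starTop T r d ≡ ⅓
starTop-ones h rewrite edge h L | edge h R | edge h B = refl

starBL-ones : ∀ {T r d} → AllOne T r d → starBL T r d ≡ ⅓
starBL-ones h rewrite edge h L | edge h R | edge h B = refl

starBR-ones : ∀ {T r d} → AllOne T r d → starBR T r d ≡ ⅓
starBR-ones h rewrite edge h L | edge h R | edge h B = refl

starBR-RB-ones : ∀ T r d {a} → T r d L ≡ a → T r d R ≡ 1ℚ → T r d B ≡ 1ℚ →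
                 starBR T r d ≡ 1ℚ ⊘ (a ℚ.+ 1ℚ ℚ.+ 1ℚ)
starBR-RB-ones T r d hL hR hB rewrite hL | hR | hB = refl

Y-Δ-⅓ : ∀ {b x y z} → b ≡ false → x ≡ ⅓ → y ≡ ⅓ → z ≡ ⅓ → join b x y z ≡ 1ℚ
Y-Δ-⅓ refl refl refl refl = refl

reduce-L-ones : ∀ {m T r d} → 0 < d →
  AllOne T r d → AllOne T r (suc d) → AllOne T (suc r) (suc d) → reduce m T r (suc d) L ≡ 1ℚ
reduce-L-ones 0<d h₀₀ h₀₁ h₁₁ =
  Y-Δ-⅓ (<⇒≤ᵇ≡false (s≤s 0<d)) (starBL-ones h₀₁) (starTop-ones h₁₁) (starBR-ones h₀₀)

reduce-R-ones : ∀ {m T r d} → d < r →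
  AllOne T r d → AllOne T r (suc d) → AllOne T (suc r) (suc d) → reduce m T r d R ≡ 1ℚ
reduce-R-ones d<r h₀₀ h₀₁ h₁₁ =
  Y-Δ-⅓ (<⇒≤ᵇ≡false d<r) (starBR-ones h₀₀) (starTop-ones h₁₁) (starBL-ones h₀₁)

reduce-B-ones : ∀ {m T r d} → suc r < m →
  AllOne T (suc r) d → AllOne T (suc r) (suc d) → AllOne T (suc (suc r)) (suc d) →
  reduce m T r d B ≡ 1ℚ
reduce-B-ones r+1<m h₁₀ h₁₁ h₂₁ =
  Y-Δ-⅓ (<⇒≤ᵇ≡false r+1<m) (starBR-ones h₁₀) (starBL-ones h₁₁) (starTop-ones h₂₁)

reduce-L-G₀ : ∀ {m T r d a} → .{{Positive a}} → 0 < d →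
  T r d L ≡ a → T r d R ≡ 1ℚ → T r d B ≡ 1ℚ →
  AllOne T r (suc d) → AllOne T (suc r) (suc d) → reduce m T r (suc d) L ≡ G₀ a
reduce-L-G₀ {T = T} {r} {d} {a} 0<d hL hR hB h₀₁ h₁₁ =
  Y-Δ-G₀ a (<⇒≤ᵇ≡false (s≤s 0<d)) (starBL-ones h₀₁) (starTop-ones h₁₁) (starBR-RB-ones T r d hL hR hB)

+-suc-≤ : ∀ x {s y} → x + suc s ≤ y → suc (x + s) ≤ y
+-suc-≤ x {s} {y} = subst (_≤ y) (+-suc x s)

m<pred[n]⇒suc[m]<n : ∀ {m n} → m < pred n → suc m < n
m<pred[n]⇒suc[m]<n {n = suc _} = s≤s

-- T_{r,d} lies at distance at least s from all three sides of the m-grid: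
-- d - 1 ≥ s, r - d ≥ s and m - r ≥ s.
InteriorOnes : ℕ → ℕ → Labels → Set
InteriorOnes m s T = ∀ {r d} → s < d → d + s ≤ r → r + s ≤ m → AllOne T r d

reduce-RB-ones : ∀ {m s T r d} → InteriorOnes m s T →
  s < d → d + suc s ≤ r → r + suc s ≤ pred m →
  reduce m T r d R ≡ 1ℚ × reduce m T r d B ≡ 1ℚ
reduce-RB-ones {m} {s} {T} {r} {d} ones s<d right bottom =
    reduce-R-ones {m = m} d<r
      (ones s<d (<⇒≤ right′) bottom₀)
      (ones s<1+d right′ bottom₀)
      (ones s<1+d (m≤n⇒m≤1+n right′) bottom₁)
  , reduce-B-ones 1+r<m
      (ones s<d (m≤n⇒m≤1+n (<⇒≤ right′)) bottom₁)
      (ones s<1+d (m≤n⇒m≤1+n right′) bottom₁)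
      (ones s<1+d (m≤n⇒m≤1+n (m≤n⇒m≤1+n right′)) bottom′)
  where
  right′ : suc (d + s) ≤ r
  right′ = +-suc-≤ d right
  bottom′ : suc (suc (r + s)) ≤ m
  bottom′ = m<pred[n]⇒suc[m]<n (+-suc-≤ r bottom)
  bottom₀ : r + s ≤ m
  bottom₀ = m+n≤o⇒n≤o 2 bottom′
  bottom₁ : suc r + s ≤ m
  bottom₁ = m+n≤o⇒n≤o 1 bottom′
  s<1+d : s < suc d
  s<1+d = m<n⇒m<1+n s<d
  d<r : d < r
  d<r = ≤-trans (s≤s (m≤m+n d s)) right′
  1+r<m : suc r < m
  1+r<m = ≤-trans (s≤s (s≤s (m≤m+n r s))) bottom′

interiorOnes-reduce : ∀ {m s T} → InteriorOnes m s T → InteriorOnes (pred m) (suc s) (reduce m T)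
interiorOnes-reduce {m} {s} {T} ones {r} {suc d} (s≤s s<d) right bottom = record { edge = edge′ }
  where
  right′ : suc (suc (d + s)) ≤ r
  right′ = +-suc-≤ (suc d) right
  bottom′ : suc (suc (r + s)) ≤ m
  bottom′ = m<pred[n]⇒suc[m]<n (+-suc-≤ r bottom)
  RB : reduce m T r (suc d) R ≡ 1ℚ × reduce m T r (suc d) B ≡ 1ℚ
  RB = reduce-RB-ones ones (m<n⇒m<1+n s<d) right bottom
  edge′ : ∀ X → reduce m T r (suc d) X ≡ 1ℚ
  edge′ L = reduce-L-ones {m = m} (≤-trans (s≤s z≤n) s<d)
    (ones s<d (m+n≤o⇒n≤o 2 right′) (m+n≤o⇒n≤o 2 bottom′))
    (ones (m<n⇒m<1+n s<d) (m+n≤o⇒n≤o 1 right′) (m+n≤o⇒n≤o 2 bottom′))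
    (ones (m<n⇒m<1+n s<d) (m≤n⇒m≤1+n (m+n≤o⇒n≤o 1 right′)) (m+n≤o⇒n≤o 1 bottom′))
  edge′ R = proj₁ RB
  edge′ B = proj₂ RB

-- The column d = s: its L-edges carry a from right margin s - 1 on, its R- and B-edges
-- are 1 from right margin s on.
record Diagonal (m s : ℕ) (a : ℚ) (T : Labels) : Set where
  field
    label-L   : ∀ {r} → s + s ≤ suc r → r + s ≤ m → T r s L ≡ a
    labels-RB : ∀ {r} → s + s ≤ r → r + s ≤ m → T r s R ≡ 1ℚ × T r s B ≡ 1ℚ
open Diagonal

diagonal-reduce : ∀ {m s a T} → .{{Positive a}} → InteriorOnes m (suc s) T → Diagonal m (suc s) a T →
  Diagonal (pred m) (suc (suc s)) (G₀ a) (reduce m T)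
diagonal-reduce {m} {s} {T = T} ones diag .label-L {r} (s≤s right) bottom =
  reduce-L-G₀ {m = m} (s≤s z≤n)
    (label-L diag (m≤n⇒m≤1+n (<⇒≤ right′)) bottom₀)
    (proj₁ RB) (proj₂ RB)
    (ones ≤-refl right′ bottom₀)
    (ones ≤-refl (m≤n⇒m≤1+n right′) (m+n≤o⇒n≤o 1 bottom′))
  where
  right′ : suc (suc s + suc s) ≤ r
  right′ = +-suc-≤ (suc s) right
  bottom′ : suc (suc (r + suc s)) ≤ m
  bottom′ = m<pred[n]⇒suc[m]<n (+-suc-≤ r bottom)
  bottom₀ : r + suc s ≤ m
  bottom₀ = m+n≤o⇒n≤o 2 bottom′
  RB : T r (suc s) R ≡ 1ℚ × T r (suc s) B ≡ 1ℚ
  RB = labels-RB diag (<⇒≤ right′) bottom₀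
diagonal-reduce ones diag .labels-RB = reduce-RB-ones ones ≤-refl

diagonal-base : ∀ m → Diagonal (pred m) 1 (+ 2 / 3) (reduce m (λ _ _ _ → 1ℚ))
diagonal-base m .label-L _ _ = refl
diagonal-base m .labels-RB = reduce-RB-ones {m = m} (λ _ _ _ → record { edge = λ _ → refl }) (s≤s z≤n)

diagonalLabel : ℕ → ℚ
diagonalLabel zero    = + 2 / 3
diagonalLabel (suc k) = G₀ (diagonalLabel k)

diagonalLabel-positive : ∀ k → Positive (diagonalLabel k)
diagonalLabel-positive zero    = _
diagonalLabel-positive (suc k) = G₀-positive (diagonalLabel k) {{diagonalLabel-positive k}}

interiorOnes-iterLabels : ∀ n s → InteriorOnes (n ∸ s) s (iterLabels n s)
interiorOnes-iterLabels n zero    _ _ _ = record { edge = λ _ → refl }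
interiorOnes-iterLabels n (suc s) =
  subst (λ m → InteriorOnes m (suc s) (iterLabels n (suc s))) (pred[m∸n]≡m∸[1+n] n s)
    (interiorOnes-reduce (interiorOnes-iterLabels n s))

diagonal-iterLabels : ∀ n k → Diagonal (n ∸ suc k) (suc k) (diagonalLabel k) (iterLabels n (suc k))
diagonal-iterLabels n zero    = diagonal-base n
diagonal-iterLabels n (suc k) =
  subst (λ m → Diagonal m (suc (suc k)) (diagonalLabel (suc k)) (iterLabels n (suc (suc k))))
    (pred[m∸n]≡m∸[1+n] n (suc k))
    (diagonal-reduce {{diagonalLabel-positive k}} (interiorOnes-iterLabels n (suc k)) (diagonal-iterLabels n k))

Tlab-diagonal : ∀ k → ∃ λ N → ∀ n → N ≤ n → Tlab n (suc k) (2 * suc k ∸ 1) (suc k) L ≡ diagonalLabel k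
Tlab-diagonal k = r + s + s , λ n N≤n →
  label-L (diagonal-iterLabels n k) (≤-reflexive 2s≡1+r) (m+n≤o⇒m≤o∸n (r + s) N≤n)
  where
  s r : ℕ
  s = suc k
  r = 2 * s ∸ 1
  2s≡1+r : s + s ≡ suc r
  2s≡1+r = cong (λ j → s + j) (sym (+-identityʳ s))

mainTheorem2 : (∃ λ N → ∀ n → N ≤ n → Tlab n 1 1 1 L ≡ + 2 / 3)
    × (∀ s → 2 ≤ s → ∃ λ N → ∀ n → N ≤ n →
        Tlab n s (2 * s ∸ 1) s L ≡ G₀ (Tlab n (s ∸ 1) (2 * s ∸ 3) (s ∸ 1) L))
mainTheorem2 = (0 , λ _ _ → refl) , recurrence
  where
  recurrence : ∀ s → 2 ≤ s → ∃ λ N → ∀ n → N ≤ n →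
    Tlab n s (2 * s ∸ 1) s L ≡ G₀ (Tlab n (s ∸ 1) (2 * s ∸ 3) (s ∸ 1) L)
  recurrence 1 (s≤s ())
  recurrence (suc (suc k)) _ with Tlab-diagonal (suc k) | Tlab-diagonal k
  ... | N₁ , T≡a₁ | N₀ , T≡a₀ = N₁ + N₀ , λ n N≤n → begin
    Tlab n (suc (suc k)) (2 * suc (suc k) ∸ 1) (suc (suc k)) L ≡⟨ T≡a₁ n (m+n≤o⇒m≤o N₁ N≤n) ⟩
    G₀ (diagonalLabel k)                                       ≡⟨ cong G₀ (sym (T≡a₀ n (m+n≤o⇒n≤o N₁ N≤n))) ⟩
    G₀ (Tlab n (suc k) (2 * suc k ∸ 1) (suc k) L)             ≡⟨ cong (λ r → G₀ (Tlab n (suc k) (r ∸ 3) (suc k) L)) (sym (*-suc 2 (suc k))) ⟩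
    G₀ (Tlab n (suc k) (2 * suc (suc k) ∸ 3) (suc k) L)       ∎
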